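{- Let $\Upsilon$ be the set of $\sim$-equivalence classes of upper primes and $\Lambda$ the set of $\sim$-equivalence classes of lower primes. Choose arbitrarily a representative $U_\upsilon\in\upsilon$ for each $\upsilon\in\Upsilon$ and a representative $D_\lambda\in\lambda$ for each $\lambda\in\Lambda$, and set $$S'''=\{U_\upsilon D_\lambda-D_\lambda U_\upsilon\colon \upsilon\in\Upsilon,\ \lambda\in\Lambda\}.$$ Then $S'''$ is a minimal subset of $S$ that generates $\mathcal{J}$: $S'''\subset S$, $S'''$ generates the two-sided ideal $\mathcal{J}$, and no proper subset of $S'''$ generates $\mathcal{J}$.
   Context: Let $\mathcal{A}$ be the free associative $\mathbb{C}$-algebra on two generators $L$ and $R$ (called letters). A word is a finite product of letters (the empty word is the identity); words form a $\mathbb{C}$-basis of $\mathcal{A}$. A word is balanced if $L$ and $R$ occur in it equally many times. Let $S=\{FG-GF\colon F,G \text{ nonempty balanced words}\}$ and let $\mathcal{J}$ be the two-sided ideal of $\mathcal{A}$ generated by $S$. For words $X,Y$ write $X\sim Y$ if $X-Y\in\mathcal{J}$. A word is prime if it is nonempty, balanced, and not a product of two nonempty balanced words. For a word $W=a_1\cdots a_n$ and $0\le k\le n$, its $k$-th elevation is $e_k(W)=\sum_{i=1}^k \overline{a_i}$, where $\overline{R}=1$, $\overline{L}=-1$. A prime word $P$ is an upper prime if $e_k(P)>0$ for all $1\le k\le l(P)-1$, and a lower prime if $e_k(P)<0$ for all $1\le k\le l(P)-1$ ($l(P)$ is the length). Equivalence classes of upper primes consist of upper primes, and likewise for lower primes.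 -}

module Defs where

open import Level using (Level; _⊔_) renaming (suc to lsuc)
open import Algebra.Bundles using (CommutativeRing)
open import Data.Nat as ℕ using (ℕ; _∸_)
open import Data.Integer as ℤ using (ℤ; +_; -[1+_])
open import Data.List using (List; []; _∷_; _++_; length; take; filter; map; foldr)
open import Data.List.Properties using (≡-dec)
open import Data.Product using (Σ; ∃; ∃-syntax; _×_; _,_)
open import Relation.Nullary using (¬_; Dec; yes; no)
open import Relation.Binary.PropositionalEquality using (_≡_; _≢_; refl)

record Field (c ℓ : Level) : Set (lsuc (c ⊔ ℓ)) where
  field
    commutativeRing : CommutativeRing c ℓ
  open CommutativeRing commutativeRing public
  field
    1≉0 : ¬ (1# ≈ 0#)
    inverse : ∀ x → ¬ (x ≈ 0#) → ∃[ y ] (x * y ≈ 1#)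

data Letter : Set where
  L R : Letter

Word : Set
Word = List Letter

letter-dec : (a b : Letter) → Dec (a ≡ b)
letter-dec L L = yes refl
letter-dec L R = no (λ ())
letter-dec R L = no (λ ())
letter-dec R R = yes refl

word-dec : (u v : Word) → Dec (u ≡ v)
word-dec = ≡-dec letter-dec

countL : Word → ℕ
countL [] = 0
countL (L ∷ w) = ℕ.suc (countL w)
countL (R ∷ w) = countL w

countR : Word → ℕ
countR [] = 0
countR (L ∷ w) = countR w
countR (R ∷ w) = ℕ.suc (countR w)

Balanced : Word → Set
Balanced w = countL w ≡ countR w

Nonempty : Word → Set
Nonempty w = w ≢ []

val : Letter → ℤ
val L = -[1+ 0 ]
val R = + 1

elev : Word → ℤ
elev [] = + 0
elev (a ∷ w) = val a ℤ.+ elev w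

elevation : ℕ → Word → ℤ
elevation k w = elev (take k w)

IsPrime : Word → Set
IsPrime w = Nonempty w × Balanced w ×
  ¬ (∃[ A ] ∃[ B ] (Nonempty A × Balanced A × Nonempty B × Balanced B × w ≡ A ++ B))

UpperPrime : Word → Set
UpperPrime P = IsPrime P ×
  (∀ k → 1 ℕ.≤ k → k ℕ.≤ length P ∸ 1 → + 0 ℤ.< elevation k P)

LowerPrime : Word → Set
LowerPrime P = IsPrime P ×
  (∀ k → 1 ℕ.≤ k → k ℕ.≤ length P ∸ 1 → elevation k P ℤ.< + 0)

-- A generating set of binomials is a predicate G on pairs of words;
-- G X Y stands for the element X - Y of the free algebra.
GenSet : Set₁
GenSet = Word → Word → Set

S : GenSet
S X Y = ∃[ F ] ∃[ G ] (Nonempty F × Balanced F × Nonempty G × Balanced G ×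
          X ≡ F ++ G × Y ≡ G ++ F)

module Algebra {c ℓ : Level} (K : Field c ℓ) where
  open Field K

  -- Elements of the free algebra K⟨L,R⟩ are represented by their
  -- coefficient functions Word → K (equality is pointwise ≈).
  Poly : Set c
  Poly = Word → Carrier

  δ : Word → Poly
  δ u w with word-dec u w
  ... | yes _ = 1#
  ... | no _ = 0#

  record Term (G : GenSet) : Set c where
    field
      coef : Carrier
      left : Word
      gx gy : Word
      gen : G gx gy
      right : Word

  evalTerm : {G : GenSet} → Term G → Poly
  evalTerm t w = Term.coef t * (δ (Term.left t ++ Term.gx t ++ Term.right t) w
                                - δ (Term.left t ++ Term.gy t ++ Term.right t) w)

  evalTerms : {G : GenSet} → List (Term G) → Poly
  evalTerms [] w = 0#
  evalTerms (t ∷ ts) w = evalTerm t w + evalTerms ts w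

  InIdeal : GenSet → Poly → Set (c ⊔ ℓ)
  InIdeal G f = ∃[ ts ] (∀ w → f w ≈ evalTerms {G} ts w)

  InJ : Poly → Set (c ⊔ ℓ)
  InJ = InIdeal S

  Generates : GenSet → Set (c ⊔ ℓ)
  Generates G = ∀ f → (InIdeal G f → InJ f) × (InJ f → InIdeal G f)

  _∼_ : Word → Word → Set (c ⊔ ℓ)
  X ∼ Y = InJ (λ w → δ X w - δ Y w)

  Representatives : (Word → Set) → (Word → Set) → Set (c ⊔ ℓ)
  Representatives Class Rep =
    (∀ U → Rep U → Class U) ×
    (∀ P → Class P → ∃[ U ] (Rep U × P ∼ U)) ×
    (∀ U V → Rep U → Rep V → U ∼ V → U ≡ V)

  S‴ : (Word → Set) → (Word → Set) → GenSet
  S‴ RepU RepD X Y = ∃[ U ] ∃[ D ] (RepU U × RepD D × X ≡ U ++ D × Y ≡ D ++ U)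

  _⊆_ : GenSet → GenSet → Set
  G ⊆ H = ∀ X Y → G X Y → H X Y

-- A prime is an up arch R M L or a down arch L M R, with M a balanced word whose lattice path
-- stays on one side of zero, and every nonempty balanced word is a product of primes.  Swapping F G into
-- G F is therefore reduced, by induction on |F| + |G|, to swapping two primes.  Two arches of the same
-- direction commute through shorter swaps inside a F′ b · a G′ b; an up arch and a down arch are first
-- replaced by their chosen representatives, which is allowed because the ∼-relations involved are
-- homogeneous and only need generators shorter than the current length.
--
-- For minimality, drop U₀D₀ - D₀U₀.  The words U D with U ∼ U₀ an up arch and D ∼ D₀ a down arch are
-- closed under every remaining swap: a swapped balanced infix lies inside U, inside D, or is U D itself,
-- and in the last case unique factorisation and the choice of representatives force it to be the dropped
-- generator.  Counting such words of length |U₀D₀| is then a linear functional vanishing on the smaller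
-- ideal but equal to 1 on U₀D₀ - D₀U₀.  Since only a contradiction is sought, decidability of this count is
-- available by double negation.

module Submission where

open import Defs
open import Level using (Level; _⊔_)
open import Data.Nat using (ℕ; zero; suc; _≤_; _<_; z≤n; s≤s; _≟_)
open import Data.List using (List; []; _∷_; _++_; [_]; length)
open import Data.List.Properties using (++-assoc; ++-identityʳ; ++-monoid; ++-cancelˡ; length-++)
open import Data.Product using (∃-syntax; _×_; _,_; proj₁; proj₂)
open import Data.Sum using (_⊎_; inj₁; inj₂)
open import Data.Empty using (⊥-elim)
open import Function using (_∘_)
open import Relation.Nullary using (¬_; Dec; yes; no)
open import Relation.Binary.PropositionalEquality
  using (_≡_; _≢_; refl; sym; trans; cong; cong₂; subst; subst₂; module ≡-Reasoning)
open import Tactic.MonoidSolver using (solve)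
import Relation.Binary.Reasoning.Setoid as SetoidReasoning

module Words where

  open import Data.Nat using (_+_; _∸_)
  open import Data.Nat.Properties
    using (+-comm; +-suc; +-identityʳ; +-monoˡ-≤; +-monoˡ-<; +-cancelˡ-≡; +-cancelʳ-≡; +-cancelˡ-≤; +-cancelˡ-<;
           ≤-reflexive; ≤-pred; ≤-trans; ≤-antisym; <⇒≤; <⇒≢; m≤m+n; m≤n+m; m≤n⇒m≤1+n; m<m+n; m<n+m;
           m≢1+n+m; suc-injective)
  import Data.Integer as ℤ
  open ℤ using (_⊖_)
  open import Data.Integer.Properties using (distribʳ-⊖-+-pos; distribʳ-⊖-+-neg; n⊖n≡0; ⊖-monoˡ-<; ⊖-monoʳ->-<)
  open import Data.List using (map; take; drop; initLast; _∷ʳ′_)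
  open import Data.List.Properties
    using (∷-injective; ∷-injectiveˡ; ∷-injectiveʳ; ∷ʳ-injective; map-++; take++drop≡id)
  open import Relation.Nullary.Decidable using (¬¬-excluded-middle)

  ++-split : ∀ (A B C D : Word) → A ++ B ≡ C ++ D →
             (∃[ X ] (C ≡ A ++ X × B ≡ X ++ D)) ⊎ (∃[ X ] (A ≡ C ++ X × D ≡ X ++ B))
  ++-split []      B C       D eq = inj₁ (C , refl , eq)
  ++-split (a ∷ A) B []      D eq = inj₂ (a ∷ A , refl , sym eq)
  ++-split (a ∷ A) B (c ∷ C) D eq with ∷-injective eq
  ... | refl , eq′ with ++-split A B C D eq′
  ...   | inj₁ (X , refl , B≡) = inj₁ (X , refl , B≡)
  ...   | inj₂ (X , refl , D≡) = inj₂ (X , refl , D≡)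

  ++-assoc₄ : ∀ (A B C D : Word) → A ++ B ++ C ++ D ≡ (A ++ B ++ C) ++ D
  ++-assoc₄ A B C D = solve (++-monoid Letter)

  ++-reassoc : ∀ (A B l x r : Word) → (A ++ l) ++ x ++ (r ++ B) ≡ A ++ (l ++ x ++ r) ++ B
  ++-reassoc A B l x r = solve (++-monoid Letter)

  ++-sandwich : ∀ (A F G B : Word) → (A ++ F ++ B) ++ (A ++ G ++ B) ≡ A ++ (F ++ (B ++ A) ++ G) ++ B
  ++-sandwich A F G B = solve (++-monoid Letter)

  prefix-view : ∀ A w → (∃[ v ] (w ≡ A ++ v)) ⊎ (∀ v → w ≢ A ++ v)
  prefix-view []      w       = inj₁ (w , refl)
  prefix-view (a ∷ A) []      = inj₂ λ _ ()
  prefix-view (a ∷ A) (b ∷ w) with letter-dec a b | prefix-view A w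
  ... | yes refl | inj₁ (v , refl) = inj₁ (v , refl)
  ... | yes refl | inj₂ ¬pre      = inj₂ λ v eq → ¬pre v (∷-injectiveʳ eq)
  ... | no a≢b   | _              = inj₂ λ v eq → a≢b (sym (∷-injectiveˡ eq))

  suffix-view : ∀ B w → (∃[ v ] (w ≡ v ++ B)) ⊎ (∀ v → w ≢ v ++ B)
  suffix-view B w with word-dec w B
  ... | yes refl = inj₁ ([] , refl)
  suffix-view B []      | no w≢B = inj₂ λ { [] eq → w≢B eq ; (_ ∷ _) () }
  suffix-view B (a ∷ w) | no w≢B with suffix-view B w
  ... | inj₁ (v , refl) = inj₁ (a ∷ v , refl)
  ... | inj₂ ¬suf       = inj₂ λ { [] eq → w≢B eq ; (_ ∷ v) eq → ¬suf v (∷-injectiveʳ eq) }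

  infix-view : ∀ A B w → (∃[ v ] (w ≡ A ++ v ++ B)) ⊎ (∀ v → w ≢ A ++ v ++ B)
  infix-view A B w with prefix-view A w
  ... | inj₂ ¬pre = inj₂ λ v eq → ¬pre (v ++ B) eq
  ... | inj₁ (z , refl) with suffix-view B z
  ...   | inj₁ (v , refl) = inj₁ (v , refl)
  ...   | inj₂ ¬suf       = inj₂ λ v eq → ¬suf v (++-cancelˡ A z (v ++ B) eq)

  length-infix : ∀ (l : Word) {x y : Word} (r : Word) → length x ≡ length y →
                 length (l ++ x ++ r) ≡ length (l ++ y ++ r)
  length-infix []      {x} {y} r eq = trans (length-++ x) (trans (cong (_+ length r) eq) (sym (length-++ y)))
  length-infix (_ ∷ l)         r eq = cong suc (length-infix l r eq)

  length-≤-infix : ∀ (l x r : Word) → length x ≤ length (l ++ x ++ r)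
  length-≤-infix []      x r = subst (length x ≤_) (sym (length-++ x {r})) (m≤m+n (length x) (length r))
  length-≤-infix (_ ∷ l) x r = m≤n⇒m≤1+n (length-≤-infix l x r)

  nonempty⇒0<length : ∀ {w : Word} → Nonempty w → 0 < length w
  nonempty⇒0<length {[]}    ne = ⊥-elim (ne refl)
  nonempty⇒0<length {_ ∷ _} _  = s≤s z≤n

  length-wrap : ∀ (a : Letter) M b → length ([ a ] ++ M ++ [ b ]) ≡ 2 + length M
  length-wrap a M b = cong suc (trans (length-++ M) (+-comm (length M) 1))

  length-<-++ˡ : ∀ (A : Word) {B} → Nonempty B → length A < length (A ++ B)
  length-<-++ˡ A neB = subst (length A <_) (sym (length-++ A)) (m<m+n (length A) (nonempty⇒0<length neB))

  length-<-++ʳ : ∀ {A} (B : Word) → Nonempty A → length B < length (A ++ B)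
  length-<-++ʳ {A} B neA = subst (length B <_) (sym (length-++ A)) (m<n+m (length B) (nonempty⇒0<length neA))

  m<n≤1+o⇒m≤o : ∀ {m n o} → m < n → n ≤ suc o → m ≤ o
  m<n≤1+o⇒m≤o m<n n≤1+o = ≤-pred (≤-trans m<n n≤1+o)

  ¬¬-decidable : ∀ {p} n (P : Word → Set p) → ¬ ¬ (∀ w → length w ≡ n → Dec (P w))
  ¬¬-decidable zero    P k = ¬¬-excluded-middle λ d → k λ { [] _ → d ; (_ ∷ _) () }
  ¬¬-decidable (suc n) P k =
    ¬¬-decidable n (P ∘ (L ∷_)) λ decL → ¬¬-decidable n (P ∘ (R ∷_)) λ decR →
    k λ { [] () ; (L ∷ w) e → decL w (suc-injective e) ; (R ∷ w) e → decR w (suc-injective e) }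

  countL-++ : ∀ x y → countL (x ++ y) ≡ countL x + countL y
  countL-++ []      y = refl
  countL-++ (L ∷ x) y = cong suc (countL-++ x y)
  countL-++ (R ∷ x) y = countL-++ x y

  countR-++ : ∀ x y → countR (x ++ y) ≡ countR x + countR y
  countR-++ []      y = refl
  countR-++ (L ∷ x) y = countR-++ x y
  countR-++ (R ∷ x) y = cong suc (countR-++ x y)

  balanced-++-counts : ∀ {x y} → Balanced (x ++ y) → countL x + countL y ≡ countR x + countR y
  balanced-++-counts {x} {y} b = trans (sym (countL-++ x y)) (trans b (countR-++ x y))

  balanced-++ : ∀ {x y} → Balanced x → Balanced y → Balanced (x ++ y)
  balanced-++ {x} {y} bx by = trans (countL-++ x y) (trans (cong₂ _+_ bx by) (sym (countR-++ x y)))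

  +-≤-transfer : ∀ {a b c d} → a + b ≡ c + d → a ≤ c → d ≤ b
  +-≤-transfer {a} {b} {c} {d} eq a≤c = +-cancelˡ-≤ c d b (subst (_≤ c + b) eq (+-monoˡ-≤ b a≤c))

  +-<-transfer : ∀ {a b c d} → a + b ≡ c + d → a < c → d < b
  +-<-transfer {a} {b} {c} {d} eq a<c =
    +-cancelˡ-< c d b (subst (_< c + b) eq (+-monoˡ-< b a<c))

  Ascending Descending : Word → Set
  Ascending w = countL w < countR w
  Descending w = countR w < countL w

  ascending⇒¬balanced : ∀ {w} → Ascending w → ¬ Balanced w
  ascending⇒¬balanced a b = <⇒≢ a b

  descending⇒¬balanced : ∀ {w} → Descending w → ¬ Balanced w
  descending⇒¬balanced d b = <⇒≢ d (sym b)

  balanced-++⁻ˡ : ∀ {x y} → Balanced (x ++ y) → Balanced y → Balanced x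
  balanced-++⁻ˡ {x} {y} bxy by =
    +-cancelʳ-≡ (countR y) _ _ (subst (λ n → countL x + n ≡ countR x + countR y) by (balanced-++-counts {x} {y} bxy))

  balanced-++⁻ʳ : ∀ {x y} → Balanced (x ++ y) → Balanced x → Balanced y
  balanced-++⁻ʳ {x} {y} bxy bx =
    +-cancelˡ-≡ (countR x) _ _ (subst (λ n → n + countL y ≡ countR x + countR y) bx (balanced-++-counts {x} {y} bxy))

  -- Walk h w h′: w read as a lattice path (R up, L down) from height h to h′ that never goes below 0.
  data Walk : ℕ → Word → ℕ → Set where
    done : ∀ {h} → Walk h [] h
    up   : ∀ {h w h′} → Walk (suc h) w h′ → Walk h (R ∷ w) h′
    down : ∀ {h w h′} → Walk h w h′ → Walk (suc h) (L ∷ w) h′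

  walk-++ : ∀ {a b c x y} → Walk a x b → Walk b y c → Walk a (x ++ y) c
  walk-++ done     q = q
  walk-++ (up p)   q = up (walk-++ p q)
  walk-++ (down p) q = down (walk-++ p q)

  walk-++⁻ : ∀ x {y a c} → Walk a (x ++ y) c → ∃[ b ] (Walk a x b × Walk b y c)
  walk-++⁻ []      p        = _ , done , p
  walk-++⁻ (R ∷ x) (up p)   with walk-++⁻ x p
  ... | b , p₁ , p₂ = b , up p₁ , p₂
  walk-++⁻ (L ∷ x) (down p) with walk-++⁻ x p
  ... | b , p₁ , p₂ = b , down p₁ , p₂

  walk-counts : ∀ {a w b} → Walk a w b → a + countR w ≡ b + countL w
  walk-counts done = refl
  walk-counts {a} {R ∷ w} (up p) = trans (+-suc a (countR w)) (walk-counts p)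
  walk-counts {_} {L ∷ w} {b} (down p) = trans (cong suc (walk-counts p)) (sym (+-suc b (countL w)))

  walk-balanced : ∀ {a w b} → Walk a w b → Balanced w → a ≡ b
  walk-balanced {a} {w} {b} p bw = +-cancelʳ-≡ (countR w) a b (trans (walk-counts p) (cong (b +_) bw))

  walk-swap : ∀ P X Y Q {a b} → Walk a (P ++ X ++ Y ++ Q) b → Balanced X → Balanced Y →
              Walk a (P ++ Y ++ X ++ Q) b
  walk-swap P X Y Q p bX bY with walk-++⁻ P p
  ... | _ , pP , p₁ with walk-++⁻ X p₁
  ... | _ , pX , p₂ with walk-++⁻ Y p₂
  ... | _ , pY , pQ with walk-balanced pX bX | walk-balanced pY bY
  ... | refl | refl = walk-++ pP (walk-++ pY (walk-++ pX pQ))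

  exit-or-walk : ∀ h w → (∃[ M ] ∃[ Q ] (w ≡ M ++ L ∷ Q × Walk h M 0)) ⊎ (∃[ b ] Walk h w b)
  exit-or-walk h       []      = inj₂ (h , done)
  exit-or-walk h       (R ∷ w) with exit-or-walk (suc h) w
  ... | inj₁ (M , Q , refl , p) = inj₁ (R ∷ M , Q , refl , up p)
  ... | inj₂ (b , p)            = inj₂ (b , up p)
  exit-or-walk zero    (L ∷ w) = inj₁ ([] , w , refl , done)
  exit-or-walk (suc h) (L ∷ w) with exit-or-walk h w
  ... | inj₁ (M , Q , refl , p) = inj₁ (L ∷ M , Q , refl , down p)
  ... | inj₂ (b , p)            = inj₂ (b , down p)

  UpArch : Word → Set
  UpArch W = ∃[ M ] (W ≡ R ∷ M ++ L ∷ [] × Walk 0 M 0)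

  upArch-inner : ∀ {U} → UpArch U → ∃[ M ] (U ≡ R ∷ M ++ L ∷ [] × Balanced M)
  upArch-inner (M , U≡ , p) = M , U≡ , sym (walk-counts p)

  upArch-balanced : ∀ {U} → UpArch U → Balanced U
  upArch-balanced u with upArch-inner u
  ... | M , refl , bM = begin
    countL (M ++ L ∷ [])       ≡⟨ countL-++ M (L ∷ []) ⟩
    countL M + 1               ≡⟨ +-comm (countL M) 1 ⟩
    suc (countL M)             ≡⟨ cong suc bM ⟩
    suc (countR M)             ≡⟨ cong suc (+-identityʳ (countR M)) ⟨
    suc (countR M + 0)         ≡⟨ cong suc (countR-++ M (L ∷ [])) ⟨
    suc (countR (M ++ L ∷ [])) ∎
    where open ≡-Reasoning

  upArch-nonempty : ∀ {U} → UpArch U → Nonempty U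
  upArch-nonempty (_ , refl , _) ()

  upArch-interior : ∀ {A V B} → UpArch (A ++ V ++ B) → Nonempty A → Nonempty B →
                    ∃[ A′ ] ∃[ B′ ] (A ≡ R ∷ A′ × B ≡ B′ ++ L ∷ [] × Walk 0 (A′ ++ V ++ B′) 0)
  upArch-interior {[]} _ neA _ = ⊥-elim (neA refl)
  upArch-interior {a ∷ A′} {V} {B} (M , eq , p) _ neB with initLast B
  ... | []        = ⊥-elim (neB refl)
  ... | B′ ∷ʳ′ b with ∷-injective eq
  ...   | refl , eq′ with ∷ʳ-injective M (A′ ++ V ++ B′) (trans (sym eq′) (solve (++-monoid Letter)))
  ...     | refl , refl = A′ , B′ , refl , refl , p

  upArch-ascending-prefix : ∀ {P Q} → UpArch (P ++ Q) → Nonempty P → Nonempty Q → Ascending P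
  upArch-ascending-prefix {P} u neP neQ with upArch-interior {P} {[]} u neP neQ
  ... | P′ , Q′ , refl , _ , p with walk-++⁻ P′ p
  ...   | k , pP′ , _ = s≤s (subst (countL P′ ≤_) (sym (walk-counts pP′)) (m≤n+m (countL P′) k))

  upArch-swap : ∀ {A X Y B} → UpArch (A ++ (X ++ Y) ++ B) → Nonempty A → Nonempty B →
                Balanced X → Balanced Y → UpArch (A ++ (Y ++ X) ++ B)
  upArch-swap {A} {X} {Y} {B} u neA neB bX bY with upArch-interior {A} {X ++ Y} u neA neB
  ... | A′ , B′ , refl , refl , p =
    A′ ++ Y ++ X ++ B′ , cong (R ∷_) (solve (++-monoid Letter)) ,
    walk-swap A′ X Y B′ (subst (λ w → Walk 0 w 0) (cong (A′ ++_) (++-assoc X Y B′)) p) bX bY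

  flipLetter : Letter → Letter
  flipLetter L = R
  flipLetter R = L

  flip : Word → Word
  flip = map flipLetter

  flip-involutive : ∀ w → flip (flip w) ≡ w
  flip-involutive []      = refl
  flip-involutive (L ∷ w) = cong (L ∷_) (flip-involutive w)
  flip-involutive (R ∷ w) = cong (R ∷_) (flip-involutive w)

  countL-flip : ∀ w → countL (flip w) ≡ countR w
  countL-flip []      = refl
  countL-flip (L ∷ w) = countL-flip w
  countL-flip (R ∷ w) = cong suc (countL-flip w)

  countR-flip : ∀ w → countR (flip w) ≡ countL w
  countR-flip []      = refl
  countR-flip (L ∷ w) = cong suc (countR-flip w)
  countR-flip (R ∷ w) = countR-flip w

  balanced-flip : ∀ {w} → Balanced w → Balanced (flip w)
  balanced-flip {w} b = trans (countL-flip w) (trans (sym b) (sym (countR-flip w)))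

  balanced-flip⁻ : ∀ {w} → Balanced (flip w) → Balanced w
  balanced-flip⁻ {w} b = subst Balanced (flip-involutive w) (balanced-flip {flip w} b)

  nonempty-flip : ∀ {w} → Nonempty w → Nonempty (flip w)
  nonempty-flip {[]}    ne = ⊥-elim (ne refl)
  nonempty-flip {_ ∷ _} _  = λ ()

  DownArch : Word → Set
  DownArch D = UpArch (flip D)

  downArch-inner : ∀ {D} → DownArch D → ∃[ M ] (D ≡ L ∷ M ++ R ∷ [] × Balanced M)
  downArch-inner {D} d with upArch-inner d
  ... | M , eq , bM = flip M , D≡ , balanced-flip {M} bM
    where
    open ≡-Reasoning
    D≡ : D ≡ L ∷ flip M ++ R ∷ []
    D≡ = begin
      D                       ≡⟨ sym (flip-involutive D) ⟩
      flip (flip D)           ≡⟨ cong flip eq ⟩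
      L ∷ flip (M ++ L ∷ [])  ≡⟨ cong (L ∷_) (map-++ flipLetter M (L ∷ [])) ⟩
      L ∷ flip M ++ R ∷ []    ∎

  downArch-balanced : ∀ {D} → DownArch D → Balanced D
  downArch-balanced {D} d = balanced-flip⁻ {D} (upArch-balanced d)

  downArch-nonempty : ∀ {D} → DownArch D → Nonempty D
  downArch-nonempty {[]} d = ⊥-elim (upArch-nonempty d refl)
  downArch-nonempty {_ ∷ _} _ = λ ()

  downArch-descending-prefix : ∀ {P Q} → DownArch (P ++ Q) → Nonempty P → Nonempty Q → Descending P
  downArch-descending-prefix {P} {Q} d neP neQ =
    subst₂ _<_ (countL-flip P) (countR-flip P)
      (upArch-ascending-prefix (subst UpArch (map-++ flipLetter P Q) d) (nonempty-flip neP) (nonempty-flip neQ))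

  downArch-swap : ∀ {A X Y B} → DownArch (A ++ (X ++ Y) ++ B) → Nonempty A → Nonempty B →
                  Balanced X → Balanced Y → DownArch (A ++ (Y ++ X) ++ B)
  downArch-swap {A} {X} {Y} {B} d neA neB bX bY =
    subst UpArch (sym (flip-infix A Y X B))
      (upArch-swap {flip A} {flip X} {flip Y} {flip B} (subst UpArch (flip-infix A X Y B) d)
                   (nonempty-flip neA) (nonempty-flip neB) (balanced-flip {X} bX) (balanced-flip {Y} bY))
    where
    flip-infix : ∀ A X Y B → flip (A ++ (X ++ Y) ++ B) ≡ flip A ++ (flip X ++ flip Y) ++ flip B
    flip-infix A X Y B = trans (map-++ flipLetter A _) (cong (flip A ++_)
                           (trans (map-++ flipLetter (X ++ Y) B) (cong (_++ flip B) (map-++ flipLetter X Y))))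

  BalancedSplit : Word → Set
  BalancedSplit F = ∃[ A ] ∃[ B ] (Nonempty A × Balanced A × Nonempty B × Balanced B × F ≡ A ++ B)

  isPrime-intro : ∀ {P} → Nonempty P → Balanced P →
                  (∀ {A B} → P ≡ A ++ B → Nonempty A → Nonempty B → ¬ Balanced A) → IsPrime P
  isPrime-intro neP bP noPrefix = neP , bP , λ (A , B , neA , bA , neB , _ , P≡) → noPrefix P≡ neA neB bA

  upArch⇒isPrime : ∀ {U} → UpArch U → IsPrime U
  upArch⇒isPrime u = isPrime-intro (upArch-nonempty u) (upArch-balanced u)
    λ { {A} refl neA neB → ascending⇒¬balanced {A} (upArch-ascending-prefix u neA neB) }

  downArch⇒isPrime : ∀ {D} → DownArch D → IsPrime D
  downArch⇒isPrime {D} d = isPrime-intro (downArch-nonempty {D} d) (downArch-balanced {D} d)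
    λ { {A} refl neA neB → descending⇒¬balanced {A} (downArch-descending-prefix d neA neB) }

  isPrime-balanced-prefix : ∀ {P A B} → IsPrime P → P ≡ A ++ B → Nonempty A → Balanced A → B ≡ []
  isPrime-balanced-prefix {B = []}    _                _   _   _  = refl
  isPrime-balanced-prefix {A = A} {b ∷ B} (_ , bP , noSplit) P≡ neA bA =
    ⊥-elim (noSplit (_ , b ∷ B , neA , bA , (λ ()) , balanced-++⁻ʳ {A} {b ∷ B} (subst Balanced P≡ bP) bA , P≡))

  isPrime-balanced-suffix : ∀ {P A B} → IsPrime P → P ≡ A ++ B → Nonempty B → Balanced B → A ≡ []
  isPrime-balanced-suffix {A = []}    _                _   _   _  = refl
  isPrime-balanced-suffix {A = a ∷ A} {B} (_ , bP , noSplit) P≡ neB bB =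
    ⊥-elim (noSplit (a ∷ A , _ , (λ ()) , balanced-++⁻ˡ {a ∷ A} {B} (subst Balanced P≡ bP) bB , neB , bB , P≡))

  isPrime-infix : ∀ {P A W B} → IsPrime P → P ≡ A ++ W ++ B → Nonempty W → Balanced W →
                  (A ≡ [] × B ≡ []) ⊎ (Nonempty A × Nonempty B)
  isPrime-infix {A = []}    pP P≡ neW bW = inj₁ (refl , isPrime-balanced-prefix pP P≡ neW bW)
  isPrime-infix {A = a ∷ A} {W} {[]}    pP P≡ neW bW
    with isPrime-balanced-suffix pP (trans P≡ (cong ((a ∷ A) ++_) (++-identityʳ W))) neW bW
  ... | ()
  isPrime-infix {A = a ∷ A} {B = b ∷ B} _ _ _ _ = inj₂ ((λ ()) , (λ ()))

  upArch-suffix-≤ : ∀ {A X} → UpArch (A ++ X) → countR X ≤ countL X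
  upArch-suffix-≤ {[]}    u = ≤-reflexive (sym (upArch-balanced u))
  upArch-suffix-≤ {_ ∷ _} {[]} u = z≤n
  upArch-suffix-≤ {A@(_ ∷ _)} {X@(_ ∷ _)} u =
    <⇒≤ (+-<-transfer (balanced-++-counts {A} {X} (upArch-balanced u)) (upArch-ascending-prefix {A} {X} u (λ ()) (λ ())))

  downArch-prefix-≤ : ∀ {Y B} → DownArch (Y ++ B) → countR Y ≤ countL Y
  downArch-prefix-≤ {[]}    d = z≤n
  downArch-prefix-≤ {Y@(_ ∷ _)} {[]} d =
    ≤-reflexive (sym (subst Balanced (++-identityʳ Y) (downArch-balanced {Y ++ []} d)))
  downArch-prefix-≤ {Y@(_ ∷ _)} {B@(_ ∷ _)} d = <⇒≤ (downArch-descending-prefix {Y} {B} d (λ ()) (λ ()))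

  -- A suffix of an up arch and a prefix of a down arch both have elevation ≤ 0, so if together they are
  -- balanced then each is.
  straddle-balanced : ∀ {A X Y B} → UpArch (A ++ X) → DownArch (Y ++ B) → Balanced (X ++ Y) → Balanced X
  straddle-balanced {A} {X} {Y} {B} u d bXY =
    ≤-antisym (+-≤-transfer counts (downArch-prefix-≤ {Y} {B} d)) (upArch-suffix-≤ {A} u)
    where
    counts : countR Y + countR X ≡ countL Y + countL X
    counts = trans (+-comm (countR Y) _) (trans (sym (balanced-++-counts {X} {Y} bXY)) (+-comm (countL X) _))

  data Placement (A W B U D : Word) : Set where
    inside-upper : ∀ B₁ → U ≡ A ++ W ++ B₁ → B ≡ B₁ ++ D → Nonempty A → Nonempty B₁ → Placement A W B U D
    inside-lower : ∀ A₂ → D ≡ A₂ ++ W ++ B → A ≡ U ++ A₂ → Nonempty A₂ → Nonempty B → Placement A W B U D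
    is-upper     : W ≡ U → Placement A W B U D
    is-lower     : W ≡ D → Placement A W B U D
    is-product   : W ≡ U ++ D → Placement A W B U D

  placement : ∀ {A W B U D} → UpArch U → DownArch D → A ++ W ++ B ≡ U ++ D → Nonempty W → Balanced W →
              Placement A W B U D
  placement {A} {W} {B} {U} {D} u d eq neW bW with ++-split A (W ++ B) U D eq
  ... | inj₂ (A₂ , refl , D≡) with isPrime-infix {D} {A₂} {W} {B} (downArch⇒isPrime {D} d) D≡ neW bW
  ...   | inj₁ (refl , refl) = is-lower (sym (trans D≡ (++-identityʳ W)))
  ...   | inj₂ (neA₂ , neB)  = inside-lower A₂ D≡ refl neA₂ neB
  placement {A} {W} {B} {U} {D} u d eq neW bW | inj₁ (X , U≡ , WB≡) with ++-split W B X D WB≡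
  ...   | inj₁ (B₁ , refl , B≡) with isPrime-infix {U} {A} {W} {B₁} (upArch⇒isPrime u) U≡ neW bW
  ...     | inj₁ (refl , refl) = is-upper (sym (trans U≡ (++-identityʳ W)))
  ...     | inj₂ (neA , neB₁)  = inside-upper B₁ U≡ B≡ neA neB₁
  placement {A} {_} {B} {U} {D} u d eq neW bW | inj₁ (X , U≡ , _) | inj₂ (Y , refl , D≡) = straddle X Y U≡ D≡ neW bW
    where
    straddle : ∀ X Y → U ≡ A ++ X → D ≡ Y ++ B → Nonempty (X ++ Y) → Balanced (X ++ Y) →
               Placement A (X ++ Y) B U D
    straddle [] Y U≡ D≡ neW bW
      with refl ← isPrime-balanced-prefix {D} {Y} {B} (downArch⇒isPrime {D} d) D≡ neW bW
      = is-lower (sym (trans D≡ (++-identityʳ Y)))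
    straddle X@(_ ∷ _) Y U≡ D≡ neW bW
      with bX ← straddle-balanced {A} {X} {Y} {B} (subst UpArch U≡ u) (subst DownArch D≡ d) bW
      with refl ← isPrime-balanced-suffix {U} {A} {X} (upArch⇒isPrime u) U≡ (λ ()) bX
      with Y | balanced-++⁻ʳ {X} {Y} bW bX
    ... | [] | _ = is-upper (trans (++-identityʳ X) (sym U≡))
    ... | Y@(_ ∷ _) | bY with refl ← isPrime-balanced-prefix {D} {Y} {B} (downArch⇒isPrime {D} d) D≡ (λ ()) bY
      = is-product (cong₂ _++_ (sym U≡) (sym (trans D≡ (++-identityʳ Y))))

  isPrime-prefix-unique : ∀ {U D U′ D′} → IsPrime U → IsPrime U′ → U ++ D ≡ U′ ++ D′ → U ≡ U′
  isPrime-prefix-unique {U} {D} {U′} {D′} pU pU′ eq with ++-split U D U′ D′ eq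
  ... | inj₁ (X , refl , _)
    with refl ← isPrime-balanced-prefix {A = U} {X} pU′ refl (proj₁ pU) (proj₁ (proj₂ pU))
    = sym (++-identityʳ U)
  ... | inj₂ (X , refl , _)
    with refl ← isPrime-balanced-prefix {A = U′} {X} pU refl (proj₁ pU′) (proj₁ (proj₂ pU′))
    = ++-identityʳ U′

  decompose-R : ∀ w → Balanced (R ∷ w) → BalancedSplit (R ∷ w) ⊎ UpArch (R ∷ w)
  decompose-R w b with exit-or-walk 0 w
  ... | inj₂ (_ , p) = ⊥-elim (m≢1+n+m (countL w) (trans b (cong suc (walk-counts p))))
  ... | inj₁ (M , [] , refl , p) = inj₂ (M , refl , p)
  ... | inj₁ (M , Q@(_ ∷ _) , refl , p) =
    inj₁ (R ∷ M ++ L ∷ [] , Q , (λ ()) , bA , (λ ()) ,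
          balanced-++⁻ʳ {R ∷ M ++ L ∷ []} (subst Balanced w≡ b) bA , w≡)
    where
    bA = upArch-balanced (M , refl , p)
    w≡ : R ∷ M ++ L ∷ Q ≡ (R ∷ M ++ L ∷ []) ++ Q
    w≡ = cong (R ∷_) (sym (++-assoc M (L ∷ []) Q))

  balancedSplit-flip⁻ : ∀ {F} → BalancedSplit (flip F) → BalancedSplit F
  balancedSplit-flip⁻ {F} (A , B , neA , bA , neB , bB , F≡) =
    flip A , flip B , nonempty-flip neA , balanced-flip {A} bA , nonempty-flip neB , balanced-flip {B} bB ,
    trans (sym (flip-involutive F)) (trans (cong flip F≡) (map-++ flipLetter A B))

  decompose : ∀ {F} → Balanced F → Nonempty F → BalancedSplit F ⊎ UpArch F ⊎ DownArch F
  decompose {[]}    _ neF = ⊥-elim (neF refl)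
  decompose {R ∷ w} b _ with decompose-R w b
  ... | inj₁ s = inj₁ s
  ... | inj₂ u = inj₂ (inj₁ u)
  decompose {L ∷ w} b _ with decompose-R (flip w) (balanced-flip {L ∷ w} b)
  ... | inj₁ s = inj₁ (balancedSplit-flip⁻ {L ∷ w} s)
  ... | inj₂ d = inj₂ (inj₂ d)

  isPrime⇒arch : ∀ {P} → IsPrime P → UpArch P ⊎ DownArch P
  isPrime⇒arch (neP , bP , noSplit) with decompose bP neP
  ... | inj₁ s = ⊥-elim (noSplit s)
  ... | inj₂ a = a

  elev-counts : ∀ w → elev w ≡ countR w ⊖ countL w
  elev-counts []      = refl
  elev-counts (R ∷ w) = trans (cong (ℤ._+_ ℤ.1ℤ) (elev-counts w)) (distribʳ-⊖-+-pos 1 (countR w) (countL w))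
  elev-counts (L ∷ w) = trans (cong (ℤ._+_ ℤ.-1ℤ) (elev-counts w)) (distribʳ-⊖-+-neg 0 (countR w) (countL w))

  ascending⇒positive : ∀ {w} → Ascending w → ℤ.+ 0 ℤ.< elev w
  ascending⇒positive {w} a =
    subst₂ ℤ._<_ (n⊖n≡0 (countL w)) (sym (elev-counts w)) (⊖-monoˡ-< (countL w) a)

  descending⇒negative : ∀ {w} → Descending w → elev w ℤ.< ℤ.+ 0
  descending⇒negative {w} d =
    subst₂ ℤ._<_ (sym (elev-counts w)) (n⊖n≡0 (countR w)) (⊖-monoʳ->-< (countR w) d)

  drop-nonempty : ∀ {k} (xs : Word) → k < length xs → Nonempty (drop k xs)
  drop-nonempty {zero}  (_ ∷ _)  _         = λ ()
  drop-nonempty {suc k} (_ ∷ xs) (s≤s k<n) = drop-nonempty xs k<n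

  take-drop-nonempty : ∀ {k} (P : Word) → 1 ≤ k → k ≤ length P ∸ 1 → Nonempty (take k P) × Nonempty (drop k P)
  take-drop-nonempty {suc k} (x ∷ xs) _ k<n = (λ ()) , drop-nonempty xs k<n
  take-drop-nonempty {suc k} [] _ ()

  upArch⇒upperPrime : ∀ {P} → UpArch P → UpperPrime P
  upArch⇒upperPrime {P} u = upArch⇒isPrime u , λ k 1≤k k≤n →
    let neT , neD = take-drop-nonempty P 1≤k k≤n
    in ascending⇒positive {take k P} (upArch-ascending-prefix (subst UpArch (sym (take++drop≡id k P)) u) neT neD)

  downArch⇒lowerPrime : ∀ {P} → DownArch P → LowerPrime P
  downArch⇒lowerPrime {P} d = downArch⇒isPrime {P} d , λ k 1≤k k≤n →
    let neT , neD = take-drop-nonempty P 1≤k k≤n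
    in descending⇒negative {take k P} (downArch-descending-prefix (subst DownArch (sym (take++drop≡id k P)) d) neT neD)

  1≤length-∷ʳ : ∀ (xs : Word) y → 1 ≤ length (xs ++ y ∷ [])
  1≤length-∷ʳ []      _ = s≤s z≤n
  1≤length-∷ʳ (_ ∷ _) _ = s≤s z≤n

  upperPrime⇒upArch : ∀ {P} → UpperPrime P → UpArch P
  upperPrime⇒upArch {P} (pP , positive) with isPrime⇒arch pP
  ... | inj₁ u = u
  ... | inj₂ d with downArch-inner {P} d
  ...   | M , refl , _ with positive 1 (s≤s z≤n) (1≤length-∷ʳ M R)
  ...     | ()

  lowerPrime⇒downArch : ∀ {P} → LowerPrime P → DownArch P
  lowerPrime⇒downArch {P} (pP , negative) with isPrime⇒arch pP
  ... | inj₂ d = d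
  ... | inj₁ u with upArch-inner u
  ...   | M , refl , _ with negative 1 (s≤s z≤n) (1≤length-∷ʳ M L)
  ...     | ℤ.+<+ ()

  downArch-++≢upArch-++ : ∀ {D U U′ D′} → DownArch D → UpArch U′ → D ++ U ≢ U′ ++ D′
  downArch-++≢upArch-++ {D} d u eq with downArch-inner {D} d | upArch-inner u
  ... | _ , refl , _ | _ , refl , _ with () ← ∷-injectiveˡ eq

  length-S : ∀ {x y} → S x y → length x ≡ length y
  length-S (F , G , _ , _ , _ , _ , refl , refl) =
    trans (length-++ F) (trans (+-comm (length F) (length G)) (sym (length-++ G)))


open Words

module FreeAlgebra {c ℓ : Level} (K : Field c ℓ) where
  open import Data.Nat.Properties using (suc-injective; ≤-trans; ≤-reflexive)
  open import Data.List using (map; filter)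
  open import Data.List.Properties using (∷-injectiveʳ; ++-cancelʳ; ++-conicalˡ; filter-accept; filter-reject)
  open import Data.List.Relation.Unary.All as All using (All; []; _∷_)
  open import Data.List.Relation.Unary.All.Properties using (all-filter; map⁺)
  open import Relation.Nullary.Decidable using (map′)
  open import Relation.Binary.Structures using (IsEquivalence)
  open import Relation.Binary.Bundles using (Setoid)

  open Field K renaming (refl to ≈-refl; sym to ≈-sym; trans to ≈-trans)
  open Defs.Algebra K
  module ≈-Reasoning = SetoidReasoning setoid
  open import Algebra.Properties.Ring ring using (x[y-z]≈xy-xz; -‿distribˡ-*; -‿distribʳ-*)
  open import Algebra.Properties.AbelianGroup +-abelianGroup using (⁻¹-∙-comm; ⁻¹-anti-homo‿-)
  open import Algebra.Properties.Group +-group using (ε⁻¹≈ε)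
  open import Algebra.Properties.CommutativeSemigroup +-commutativeSemigroup using (interchange)

  x-x≈0 : ∀ x → x - x ≈ 0#
  x-x≈0 = -‿inverseʳ

  k[x-x]≈0 : ∀ k x → k * (x - x) ≈ 0#
  k[x-x]≈0 k x = ≈-trans (*-cong ≈-refl (x-x≈0 x)) (zeroʳ k)

  [x-y]+[y-z]≈x-z : ∀ x y z → (x - y) + (y - z) ≈ x - z
  [x-y]+[y-z]≈x-z x y z = begin
    (x - y) + (y - z)   ≈⟨ +-assoc x (- y) (y - z) ⟩
    x + (- y + (y - z)) ≈⟨ +-cong ≈-refl (+-assoc (- y) y (- z)) ⟨
    x + ((- y + y) - z) ≈⟨ +-cong ≈-refl (+-cong (-‿inverseˡ y) ≈-refl) ⟩
    x + (0# - z)        ≈⟨ +-cong ≈-refl (+-identityˡ (- z)) ⟩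
    x - z               ∎
    where open ≈-Reasoning

  k[x-y]+k[y-z]≈k[x-z] : ∀ k x y z → k * (x - y) + k * (y - z) ≈ k * (x - z)
  k[x-y]+k[y-z]≈k[x-z] k x y z = ≈-trans (≈-sym (distribˡ k _ _)) (*-cong ≈-refl ([x-y]+[y-z]≈x-z x y z))

  [-k][x-y]≈k[y-x] : ∀ k x y → (- k) * (x - y) ≈ k * (y - x)
  [-k][x-y]≈k[y-x] k x y = begin
    (- k) * (x - y) ≈⟨ -‿distribˡ-* k (x - y) ⟨
    - (k * (x - y)) ≈⟨ -‿distribʳ-* k (x - y) ⟩
    k * - (x - y)   ≈⟨ *-cong ≈-refl (⁻¹-anti-homo‿- x y) ⟩
    k * (y - x)     ∎
    where open ≈-Reasoning

  δ-self : ∀ u → δ u u ≡ 1#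
  δ-self u with word-dec u u
  ... | yes _ = refl
  ... | no u≢u = ⊥-elim (u≢u refl)

  δ-≢ : ∀ {u w} → u ≢ w → δ u w ≡ 0#
  δ-≢ {u} {w} u≢w with word-dec u w
  ... | yes u≡w = ⊥-elim (u≢w u≡w)
  ... | no _    = refl

  δ-length : ∀ u w → length u ≢ length w → δ u w ≡ 0#
  δ-length u w ≢ = δ-≢ {u} {w} (≢ ∘ cong length)

  δ-injective : ∀ (f : Word → Word) → (∀ {u w} → f u ≡ f w → u ≡ w) → ∀ u w → δ (f u) (f w) ≡ δ u w
  δ-injective f f-inj u w with word-dec u w
  ... | yes refl = δ-self (f u)
  ... | no u≢w   = δ-≢ (u≢w ∘ f-inj)

  sumLength : ℕ → (Word → Carrier) → Carrier
  sumLength zero    h = h []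
  sumLength (suc n) h = sumLength n (h ∘ (L ∷_)) + sumLength n (h ∘ (R ∷_))

  sumLength-cong : ∀ n {f g : Word → Carrier} → (∀ w → f w ≈ g w) → sumLength n f ≈ sumLength n g
  sumLength-cong zero    f≈g = f≈g []
  sumLength-cong (suc n) f≈g = +-cong (sumLength-cong n (f≈g ∘ (L ∷_))) (sumLength-cong n (f≈g ∘ (R ∷_)))

  sumLength-+ : ∀ n (f g : Word → Carrier) → sumLength n (λ w → f w + g w) ≈ sumLength n f + sumLength n g
  sumLength-+ zero    f g = ≈-refl
  sumLength-+ (suc n) f g =
    ≈-trans (+-cong (sumLength-+ n _ _) (sumLength-+ n _ _)) (interchange _ _ _ _)

  sumLength-neg : ∀ n (f : Word → Carrier) → sumLength n (λ w → - f w) ≈ - sumLength n f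
  sumLength-neg zero    f = ≈-refl
  sumLength-neg (suc n) f = ≈-trans (+-cong (sumLength-neg n _) (sumLength-neg n _)) (⁻¹-∙-comm _ _)

  sumLength-− : ∀ n (f g : Word → Carrier) → sumLength n (λ w → f w - g w) ≈ sumLength n f - sumLength n g
  sumLength-− n f g = ≈-trans (sumLength-+ n f (λ w → - g w)) (+-cong ≈-refl (sumLength-neg n g))

  sumLength-zero : ∀ n {f : Word → Carrier} → (∀ w → length w ≡ n → f w ≈ 0#) → sumLength n f ≈ 0#
  sumLength-zero zero    f≈0 = f≈0 [] refl
  sumLength-zero (suc n) f≈0 =
    ≈-trans (+-cong (sumLength-zero n λ w e → f≈0 (L ∷ w) (cong suc e))
                    (sumLength-zero n λ w e → f≈0 (R ∷ w) (cong suc e)))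
            (+-identityʳ 0#)

  sumLength-single : ∀ n {f : Word → Carrier} V → length V ≡ n → (∀ w → w ≢ V → f w ≈ 0#) →
                     sumLength n f ≈ f V
  sumLength-single zero    []      _ _   = ≈-refl
  sumLength-single (suc n) (L ∷ V) e f≈0 =
    ≈-trans (+-cong (sumLength-single n V (suc-injective e) λ w w≢V → f≈0 (L ∷ w) (w≢V ∘ ∷-injectiveʳ))
                    (sumLength-zero n λ w _ → f≈0 (R ∷ w) λ ()))
            (+-identityʳ _)
  sumLength-single (suc n) (R ∷ V) e f≈0 =
    ≈-trans (+-cong (sumLength-zero n λ w _ → f≈0 (L ∷ w) λ ())
                    (sumLength-single n V (suc-injective e) λ w w≢V → f≈0 (R ∷ w) (w≢V ∘ ∷-injectiveʳ)))
            (+-identityˡ _)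

  h*δ≈0 : ∀ h {V w : Word} → w ≢ V → h * δ V w ≈ 0#
  h*δ≈0 h w≢V = ≈-trans (*-cong ≈-refl (reflexive (δ-≢ (w≢V ∘ sym)))) (zeroʳ h)

  sumLength-δ : ∀ n (h : Word → Carrier) V → length V ≡ n → sumLength n (λ w → h w * δ V w) ≈ h V
  sumLength-δ n h V e = ≈-trans (sumLength-single n V e λ w → h*δ≈0 (h w) )
                                (≈-trans (*-cong ≈-refl (reflexive (δ-self V))) (*-identityʳ (h V)))

  sumLength-δ-≢ : ∀ n (h : Word → Carrier) V → length V ≢ n → sumLength n (λ w → h w * δ V w) ≈ 0#
  sumLength-δ-≢ n h V ≢n = sumLength-zero n λ w e → h*δ≈0 (h w) {V} {w} λ { refl → ≢n e }

  sumLength-δ-δ : ∀ n (h : Word → Carrier) P Q → sumLength n (λ w → h w * (δ P w - δ Q w)) ≈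
                              sumLength n (λ w → h w * δ P w) - sumLength n (λ w → h w * δ Q w)
  sumLength-δ-δ n h P Q = ≈-trans (sumLength-cong n λ w → x[y-z]≈xy-xz (h w) (δ P w) (δ Q w)) (sumLength-− n _ _)

  indicator : ∀ {p} {A : Set p} → Dec A → Carrier
  indicator (yes _) = 1#
  indicator (no _)  = 0#

  indicator-yes : ∀ {p} {A : Set p} (a : Dec A) → A → indicator a ≈ 1#
  indicator-yes (yes _) _ = ≈-refl
  indicator-yes (no ¬a) a = ⊥-elim (¬a a)

  indicator-no : ∀ {p} {A : Set p} (a : Dec A) → ¬ A → indicator a ≈ 0#
  indicator-no (yes a) ¬a = ⊥-elim (¬a a)
  indicator-no (no _)  _  = ≈-refl

  indicator-cong : ∀ {p q} {A : Set p} {B : Set q} → (A → B) → (B → A) → (a : Dec A) (b : Dec B) →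
                   indicator a ≈ indicator b
  indicator-cong _   _   (yes _) (yes _) = ≈-refl
  indicator-cong _   _   (no _)  (no _)  = ≈-refl
  indicator-cong A→B _   (yes a) (no ¬b) = ⊥-elim (¬b (A→B a))
  indicator-cong _   B→A (no ¬a) (yes b) = ⊥-elim (¬a (B→A b))

  -- If P is closed under the moves of G, counting the words of length |X| satisfying P is a linear functional
  -- that kills every G-term but takes the value 1 on X - Y.
  separation : ∀ {G} → (∀ {x y} → G x y → length x ≡ length y) →
               ∀ {p} (P : Word → Set p) →
               (∀ l r {x y} → G x y → P (l ++ x ++ r) → P (l ++ y ++ r)) →
               (∀ l r {x y} → G x y → P (l ++ y ++ r) → P (l ++ x ++ r)) →
               ∀ {X Y} → (∀ w → length w ≡ length X → Dec (P w)) → P X → ¬ P Y →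
               ¬ InIdeal G (λ w → δ X w - δ Y w)
  separation {G} length-G P forward backward {X} {Y} P? pX ¬pY (ts , X-Y≈ts) =
    1≉0 (begin
      1#                                  ≈⟨ Φ[X-Y]≈1 ⟨
      Φ (λ w → δ X w - δ Y w)             ≈⟨ sumLength-cong n (λ w → *-cong ≈-refl (X-Y≈ts w)) ⟩
      Φ (evalTerms ts)                    ≈⟨ Φ-terms ts ⟩
      0#                                  ∎)
    where
    open ≈-Reasoning
    n = length X

    Counted : Word → Set _
    Counted w = length w ≡ n × P w

    Counted? : ∀ w → Dec (Counted w)
    Counted? w with length w ≟ n
    ... | yes e = map′ (e ,_) proj₂ (P? w e)
    ... | no ≢n = no (≢n ∘ proj₁)

    weight : Word → Carrier
    weight w = indicator (Counted? w)

    Φ : Poly → Carrier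
    Φ f = sumLength n (λ w → weight w * f w)

    Φ-term : ∀ t → Φ (evalTerm {G} t) ≈ 0#
    Φ-term t = begin
      Φ (evalTerm t)                                             ≈⟨ sumLength-cong n (λ w → *-assoc (weight w) k _) ⟨
      sumLength n (λ w → h w * (δ V w - δ W w))                  ≈⟨ sumLength-δ-δ n h V W ⟩
      sumLength n (λ w → h w * δ V w) - sumLength n (λ w → h w * δ W w) ≈⟨ cancel (length V ≟ n) ⟩
      0#                                                         ∎
      where
      open Term t renaming (coef to k)
      V = left ++ gx ++ right
      W = left ++ gy ++ right
      h : Word → Carrier
      h w = weight w * k
      |V|≡|W| : length V ≡ length W
      |V|≡|W| = length-infix left right (length-G gen)
      hV≈hW : h V ≈ h W
      hV≈hW = *-cong (indicator-cong (λ (e , p) → trans (sym |V|≡|W|) e , forward left right gen p)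
                                     (λ (e , p) → trans |V|≡|W| e , backward left right gen p)
                                     (Counted? V) (Counted? W))
                     ≈-refl
      cancel : Dec (length V ≡ n) → sumLength n (λ w → h w * δ V w) - sumLength n (λ w → h w * δ W w) ≈ 0#
      cancel (yes e) = ≈-trans (+-cong (sumLength-δ n h V e)
                                        (-‿cong (sumLength-δ n h W (trans (sym |V|≡|W|) e))))
                               (≈-trans (+-cong hV≈hW ≈-refl) (x-x≈0 (h W)))
      cancel (no ≢n) = ≈-trans (+-cong (sumLength-δ-≢ n h V ≢n)
                                        (-‿cong (sumLength-δ-≢ n h W (≢n ∘ trans |V|≡|W|))))
                               (x-x≈0 0#)

    Φ-terms : ∀ ts → Φ (evalTerms {G} ts) ≈ 0#
    Φ-terms []       = sumLength-zero n λ w _ → zeroʳ (weight w)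
    Φ-terms (t ∷ ts) = begin
      Φ (evalTerms (t ∷ ts))                   ≈⟨ sumLength-cong n (λ w → distribˡ (weight w) _ _) ⟩
      sumLength n (λ w → weight w * evalTerm t w + weight w * evalTerms ts w) ≈⟨ sumLength-+ n _ _ ⟩
      Φ (evalTerm t) + Φ (evalTerms ts)        ≈⟨ +-cong (Φ-term t) (Φ-terms ts) ⟩
      0# + 0#                                  ≈⟨ +-identityʳ 0# ⟩
      0#                                       ∎

    Φ[X-Y]≈1 : Φ (λ w → δ X w - δ Y w) ≈ 1#
    Φ[X-Y]≈1 = begin
      Φ (λ w → δ X w - δ Y w)                              ≈⟨ sumLength-δ-δ n weight X Y ⟩
      sumLength n (λ w → weight w * δ X w) - sumLength n (λ w → weight w * δ Y w)
                                                           ≈⟨ +-cong (sumLength-δ n weight X refl) (-‿cong Y-term) ⟩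
      weight X - 0#                                        ≈⟨ +-cong (indicator-yes (Counted? X) (refl , pX)) ≈-refl ⟩
      1# - 0#                                              ≈⟨ +-cong ≈-refl ε⁻¹≈ε ⟩
      1# + 0#                                              ≈⟨ +-identityʳ 1# ⟩
      1#                                                   ∎
      where
      Y-term : sumLength n (λ w → weight w * δ Y w) ≈ 0#
      Y-term with length Y ≟ n
      ... | no ≢n = sumLength-δ-≢ n weight Y ≢n
      ... | yes e = ≈-trans (sumLength-δ n weight Y e) (indicator-no (Counted? Y) (¬pY ∘ proj₂))

  evalTerms-++ : ∀ {G} (ts us : List (Term G)) w → evalTerms (ts ++ us) w ≈ evalTerms ts w + evalTerms us w
  evalTerms-++ []       us w = ≈-sym (+-identityˡ _)
  evalTerms-++ (t ∷ ts) us w = ≈-trans (+-cong ≈-refl (evalTerms-++ ts us w)) (≈-sym (+-assoc _ _ _))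

  -- Quantifying over all contexts A, B and coefficients k makes this relation a congruence for ++ by
  -- construction.
  _∼[_]_ : Word → GenSet → Word → Set (c ⊔ ℓ)
  X ∼[ G ] Y = ∀ A B k → ∃[ ts ] (∀ w → evalTerms {G} ts w ≈ k * (δ (A ++ X ++ B) w - δ (A ++ Y ++ B) w))

  module _ {G : GenSet} where

    ∼[]-refl : ∀ {X} → X ∼[ G ] X
    ∼[]-refl A B k = [] , λ w → ≈-sym (k[x-x]≈0 k _)

    ∼[]-reflexive : ∀ {X Y} → X ≡ Y → X ∼[ G ] Y
    ∼[]-reflexive refl = ∼[]-refl

    ∼[]-sym : ∀ {X Y} → X ∼[ G ] Y → Y ∼[ G ] X
    ∼[]-sym X∼Y A B k with X∼Y A B (- k)
    ... | ts , eq = ts , λ w → ≈-trans (eq w) ([-k][x-y]≈k[y-x] k _ _)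

    ∼[]-trans : ∀ {X Y Z} → X ∼[ G ] Y → Y ∼[ G ] Z → X ∼[ G ] Z
    ∼[]-trans X∼Y Y∼Z A B k with X∼Y A B k | Y∼Z A B k
    ... | ts , eq | us , eq′ = ts ++ us , λ w →
      ≈-trans (evalTerms-++ ts us w) (≈-trans (+-cong (eq w) (eq′ w)) (k[x-y]+k[y-z]≈k[x-z] k _ _ _))

    ∼[]-generator : ∀ {x y} → G x y → x ∼[ G ] y
    ∼[]-generator {x} {y} g A B k =
      (record { coef = k ; left = A ; gx = x ; gy = y ; gen = g ; right = B } ∷ []) , λ w → +-identityʳ _

    ∼[]-infix : ∀ {X Y} A′ B′ → X ∼[ G ] Y → (A′ ++ X ++ B′) ∼[ G ] (A′ ++ Y ++ B′)
    ∼[]-infix {X} {Y} A′ B′ X∼Y A B k with X∼Y (A ++ A′) (B′ ++ B) k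
    ... | ts , eq = ts , λ w → ≈-trans (eq w) (*-cong ≈-refl (+-cong (δ-reassoc X w) (-‿cong (δ-reassoc Y w))))
      where
      δ-reassoc : ∀ Z w → δ ((A ++ A′) ++ Z ++ (B′ ++ B)) w ≈ δ (A ++ (A′ ++ Z ++ B′) ++ B) w
      δ-reassoc Z w = reflexive (cong (λ u → δ u w) (++-reassoc A B A′ Z B′))

    ∼[]-isEquivalence : IsEquivalence (_∼[ G ]_)
    ∼[]-isEquivalence = record { refl = ∼[]-refl ; sym = ∼[]-sym ; trans = ∼[]-trans }

    ∼[]-setoid : Setoid _ _
    ∼[]-setoid = record { isEquivalence = ∼[]-isEquivalence }

    ∼[]-++ˡ : ∀ {X Y} A′ → X ∼[ G ] Y → (A′ ++ X) ∼[ G ] (A′ ++ Y)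
    ∼[]-++ˡ {X} {Y} A′ X∼Y =
      subst₂ _∼[ G ]_ (cong (A′ ++_) (++-identityʳ X)) (cong (A′ ++_) (++-identityʳ Y)) (∼[]-infix A′ [] X∼Y)

    ∼[]-++ʳ : ∀ {X Y} B′ → X ∼[ G ] Y → (X ++ B′) ∼[ G ] (Y ++ B′)
    ∼[]-++ʳ = ∼[]-infix []

    ∼[]-rotate : ∀ {X Y Z} → (X ++ Z) ∼[ G ] (Z ++ X) → (X ++ Y) ∼[ G ] (Y ++ X) → (Z ++ Y) ∼[ G ] (Y ++ Z) →
                 (X ++ Z ++ Y) ∼[ G ] (Y ++ Z ++ X)
    ∼[]-rotate {X} {Y} {Z} XZ∼ZX XY∼YX ZY∼YZ = begin
      X ++ Z ++ Y     ≡⟨ ++-assoc X Z Y ⟨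
      (X ++ Z) ++ Y   ≈⟨ ∼[]-++ʳ Y XZ∼ZX ⟩
      (Z ++ X) ++ Y   ≡⟨ ++-assoc Z X Y ⟩
      Z ++ X ++ Y     ≈⟨ ∼[]-++ˡ Z XY∼YX ⟩
      Z ++ Y ++ X     ≡⟨ ++-assoc Z Y X ⟨
      (Z ++ Y) ++ X   ≈⟨ ∼[]-++ʳ X ZY∼YZ ⟩
      (Y ++ Z) ++ X   ≡⟨ ++-assoc Y Z X ⟩
      Y ++ Z ++ X     ∎
      where open SetoidReasoning ∼[]-setoid

  reexpress : ∀ {G H} (ts : List (Term G)) → All (λ t → Term.gx t ∼[ H ] Term.gy t) ts →
              ∃[ us ] (∀ w → evalTerms {H} us w ≈ evalTerms ts w)
  reexpress []       []            = [] , λ _ → ≈-refl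
  reexpress (t ∷ ts) (t∼ ∷ ts∼)
    with t∼ (Term.left t) (Term.right t) (Term.coef t) | reexpress ts ts∼
  ... | us₁ , eq₁ | us₂ , eq₂ =
    us₁ ++ us₂ , λ w → ≈-trans (evalTerms-++ us₁ us₂ w) (+-cong (eq₁ w) (eq₂ w))

  InIdeal-mono : ∀ {G H} → G ⊆ H → ∀ {f} → InIdeal G f → InIdeal H f
  InIdeal-mono G⊆H (ts , f≈ts) with reexpress ts (All.universal (λ t → ∼[]-generator (G⊆H _ _ (Term.gen t))) ts)
  ... | us , us≈ts = us , λ w → ≈-trans (f≈ts w) (≈-sym (us≈ts w))

  ∼-step : ∀ {x y} → S x y → ∀ l r → (l ++ x ++ r) ∼ (l ++ y ++ r)
  ∼-step g l r with ∼[]-generator g l r 1#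
  ... | ts , eq = ts , λ w → ≈-sym (≈-trans (eq w) (*-identityˡ _))

  ∼-generator : ∀ {x y} → S x y → x ∼ y
  ∼-generator {x} {y} g = subst₂ _∼_ (++-identityʳ x) (++-identityʳ y) (∼-step g [] [])

  ∼-refl : ∀ {X} → X ∼ X
  ∼-refl {X} = [] , λ w → x-x≈0 (δ X w)

  ∼-trans : ∀ {X Y Z} → X ∼ Y → Y ∼ Z → X ∼ Z
  ∼-trans {X} {Y} {Z} (ts , eq) (us , eq′) = ts ++ us , λ w →
    ≈-trans (≈-sym ([x-y]+[y-z]≈x-z (δ X w) (δ Y w) (δ Z w)))
            (≈-trans (+-cong (eq w) (eq′ w)) (≈-sym (evalTerms-++ ts us w)))

  length-∼ : ∀ {X Y} → X ∼ Y → length X ≡ length Y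
  length-∼ {X} {Y} X∼Y with length Y ≟ length X
  ... | yes e = sym e
  ... | no ≢X = ⊥-elim (separation {S} length-S (λ w → length w ≡ length X)
                          (λ l r g e → trans (sym (length-infix l r (length-S g))) e)
                          (λ l r g e → trans (length-infix l r (length-S g)) e)
                          {X} {Y} (λ w _ → length w ≟ length X) refl ≢X X∼Y)

  termWord : ∀ {G} → Term G → Word
  termWord t = Term.left t ++ Term.gx t ++ Term.right t

  evalTerm-≢ : ∀ (t : Term S) {w} → length (termWord t) ≢ length w → evalTerm t w ≈ 0#
  evalTerm-≢ t {w} ≢w = ≈-trans (*-cong ≈-refl (+-cong (reflexive (δ-length (left ++ gx ++ right) w ≢w))
                                   (-‿cong (reflexive (δ-length (left ++ gy ++ right) w (≢w ∘ trans |x|≡|y|))))))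
                                (k[x-x]≈0 (Term.coef t) 0#)
    where
    open Term t
    |x|≡|y| : length (left ++ gx ++ right) ≡ length (left ++ gy ++ right)
    |x|≡|y| = length-infix left right (length-S gen)

  hasLength? : ∀ m (t : Term S) → Dec (length (termWord t) ≡ m)
  hasLength? m t = length (termWord t) ≟ m

  ofLength : ℕ → List (Term S) → List (Term S)
  ofLength m = filter (hasLength? m)

  evalTerms-≡ : ∀ {G} {ts us : List (Term G)} → ts ≡ us → ∀ w → evalTerms ts w ≈ evalTerms us w
  evalTerms-≡ refl w = ≈-refl

  evalTerms-ofLength : ∀ m ts {w} → length w ≡ m → evalTerms (ofLength m ts) w ≈ evalTerms ts w
  evalTerms-ofLength m []       _ = ≈-refl
  evalTerms-ofLength m (t ∷ ts) {w} e with hasLength? m t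
  ... | yes tm = ≈-trans (evalTerms-≡ (filter-accept (hasLength? m) {t} {ts} tm) w)
                         (+-cong ≈-refl (evalTerms-ofLength m ts e))
  ... | no ¬tm = ≈-trans (evalTerms-≡ (filter-reject (hasLength? m) {t} {ts} ¬tm) w)
                         (≈-trans (evalTerms-ofLength m ts e)
                                  (≈-sym (≈-trans (+-cong (evalTerm-≢ t (¬tm ∘ λ e′ → trans e′ e)) ≈-refl)
                                                  (+-identityˡ _))))

  evalTerms-ofLength-≢ : ∀ m ts {w} → length w ≢ m → evalTerms (ofLength m ts) w ≈ 0#
  evalTerms-ofLength-≢ m []       _  = ≈-refl
  evalTerms-ofLength-≢ m (t ∷ ts) {w} ≢m with hasLength? m t
  ... | yes tm = ≈-trans (evalTerms-≡ (filter-accept (hasLength? m) {t} {ts} tm) w)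
                   (≈-trans (+-cong (evalTerm-≢ t (λ e′ → ≢m (trans (sym e′) tm)))
                                    (evalTerms-ofLength-≢ m ts ≢m))
                            (+-identityʳ 0#))
  ... | no ¬tm = ≈-trans (evalTerms-≡ (filter-reject (hasLength? m) {t} {ts} ¬tm) w) (evalTerms-ofLength-≢ m ts ≢m)

  -- Since 𝒥 is homogeneous, a relation X ∼ Y only needs generators no longer than X.
  homogeneous-part : ∀ {X Y} → X ∼ Y → ∃[ ts ] ((∀ v → δ X v - δ Y v ≈ evalTerms ts v) ×
                                                 All (λ t → length (Term.gx t) ≤ length X) ts)
  homogeneous-part {X} {Y} (ts , X-Y≈ts) =
    ofLength m ts , X-Y≈ , All.map (λ {t} → short {t}) (all-filter (hasLength? m) ts)
    where
    m = length X
    short : ∀ {t} → length (termWord t) ≡ m → length (Term.gx t) ≤ m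
    short {t} e = ≤-trans (length-≤-infix (Term.left t) (Term.gx t) (Term.right t)) (≤-reflexive e)
    X-Y≈ : ∀ v → δ X v - δ Y v ≈ evalTerms (ofLength m ts) v
    X-Y≈ v with length v ≟ m
    ... | yes e = ≈-trans (X-Y≈ts v) (≈-sym (evalTerms-ofLength m ts e))
    ... | no ≢m = ≈-trans (+-cong (reflexive (δ-length X v (≢m ∘ sym)))
                                  (-‿cong (reflexive (δ-length Y v (≢m ∘ sym ∘ trans |X|≡|Y|)))))
                          (≈-trans (x-x≈0 0#) (≈-sym (evalTerms-ofLength-≢ m ts ≢m)))
      where
      |X|≡|Y| : length X ≡ length Y
      |X|≡|Y| = length-∼ {X} {Y} (ts , X-Y≈ts)

  inContext : ∀ {G} → Word → Word → Term G → Term G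
  inContext A B t = record t { left = A ++ Term.left t ; right = Term.right t ++ B }

  scale : ∀ {G} → Carrier → Term G → Term G
  scale k t = record t { coef = k * Term.coef t }

  evalTerms-scale : ∀ {G} k (ts : List (Term G)) w → evalTerms (map (scale k) ts) w ≈ k * evalTerms ts w
  evalTerms-scale k []       w = ≈-sym (zeroʳ k)
  evalTerms-scale k (t ∷ ts) w =
    ≈-trans (+-cong (*-assoc k _ _) (evalTerms-scale k ts w)) (≈-sym (distribˡ k _ _))

  δ-infix : ∀ A B u v → δ (A ++ u ++ B) (A ++ v ++ B) ≡ δ u v
  δ-infix A B = δ-injective (λ u → A ++ u ++ B) (λ {u} {v} e → ++-cancelʳ B u v (++-cancelˡ A (u ++ B) (v ++ B) e))

  evalTerms-inContext : ∀ {G} A B (ts : List (Term G)) {X Y} → (∀ v → δ X v - δ Y v ≈ evalTerms ts v) →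
                        ∀ w → evalTerms (map (inContext A B) ts) w ≈ δ (A ++ X ++ B) w - δ (A ++ Y ++ B) w
  evalTerms-inContext {G} A B ts {X} {Y} X-Y≈ts w with infix-view A B w
  ... | inj₁ (v , refl) = begin
    evalTerms (map (inContext A B) ts) (A ++ v ++ B)                ≈⟨ inside ts ⟩
    evalTerms ts v                                                  ≈⟨ X-Y≈ts v ⟨
    δ X v - δ Y v                                                   ≈⟨ +-cong (reflexive (sym (δ-infix A B X v)))
                                                                              (-‿cong (reflexive (sym (δ-infix A B Y v)))) ⟩
    δ (A ++ X ++ B) (A ++ v ++ B) - δ (A ++ Y ++ B) (A ++ v ++ B)   ∎
    where
    open ≈-Reasoning
    δ-shift : ∀ l x r → δ ((A ++ l) ++ x ++ (r ++ B)) (A ++ v ++ B) ≡ δ (l ++ x ++ r) v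
    δ-shift l x r = trans (cong (λ u → δ u (A ++ v ++ B)) (++-reassoc A B l x r)) (δ-infix A B (l ++ x ++ r) v)
    inside : ∀ (ts : List (Term G)) → evalTerms (map (inContext A B) ts) (A ++ v ++ B) ≈ evalTerms ts v
    inside []       = ≈-refl
    inside (t ∷ ts) = +-cong (*-cong ≈-refl (+-cong (reflexive (δ-shift left gx right))
                                                    (-‿cong (reflexive (δ-shift left gy right)))))
                             (inside ts)
      where open Term t
  ... | inj₂ outside =
    ≈-trans (outside-terms ts) (≈-sym (≈-trans (+-cong (δ-outside X) (-‿cong (δ-outside Y))) (x-x≈0 0#)))
    where
    δ-outside : ∀ u → δ (A ++ u ++ B) w ≈ 0#
    δ-outside u = reflexive (δ-≢ λ e → outside u (sym e))
    δ-outside′ : ∀ l x r → δ ((A ++ l) ++ x ++ (r ++ B)) w ≈ 0#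
    δ-outside′ l x r = ≈-trans (reflexive (cong (λ u → δ u w) (++-reassoc A B l x r))) (δ-outside (l ++ x ++ r))
    outside-terms : ∀ (ts : List (Term G)) → evalTerms (map (inContext A B) ts) w ≈ 0#
    outside-terms []       = ≈-refl
    outside-terms (t ∷ ts) =
      ≈-trans (+-cong (≈-trans (*-cong ≈-refl (+-cong (δ-outside′ left gx right)
                                                      (-‿cong (δ-outside′ left gy right))))
                               (k[x-x]≈0 coef 0#))
                      (outside-terms ts))
              (+-identityʳ 0#)
      where open Term t

  lift-bounded : ∀ {H n} → (∀ {x y} → S x y → length x ≤ n → x ∼[ H ] y) →
                 ∀ {X Y} → X ∼ Y → length X ≤ n → X ∼[ H ] Y
  lift-bounded {H} short-swaps {X} {Y} X∼Y X≤n A B k with homogeneous-part {X} {Y} X∼Y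
  ... | ts , X-Y≈ts , short
    with reexpress (map (scale k) (map (inContext A B) ts))
                   (map⁺ (map⁺ (All.map (λ {t} t≤ → short-swaps (Term.gen t) (≤-trans t≤ X≤n)) short)))
  ... | us , us≈ = us , λ w → begin
    evalTerms us w                                        ≈⟨ us≈ w ⟩
    evalTerms (map (scale k) (map (inContext A B) ts)) w  ≈⟨ evalTerms-scale k (map (inContext A B) ts) w ⟩
    k * evalTerms (map (inContext A B) ts) w              ≈⟨ *-cong ≈-refl (evalTerms-inContext A B ts X-Y≈ts w) ⟩
    k * (δ (A ++ X ++ B) w - δ (A ++ Y ++ B) w)           ∎
    where open ≈-Reasoning

  module Factorisation (U₀ D₀ : Word) where

    Factorises : Word → Set (c ⊔ ℓ)
    Factorises w = ∃[ U ] ∃[ D ] (w ≡ U ++ D × UpArch U × U ∼ U₀ × DownArch D × D ∼ D₀)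

    factorises-swap : ∀ {X Y} l r → Nonempty X → Balanced X → Nonempty Y → Balanced Y → ¬ Factorises (X ++ Y) →
                      Factorises (l ++ (X ++ Y) ++ r) → Factorises (l ++ (Y ++ X) ++ r)
    factorises-swap {X} {Y} l r neX bX neY bY ¬fXY (U , D , w≡ , uU , U∼ , dD , D∼)
      with placement {l} {X ++ Y} {r} uU dD w≡ (λ e → neX (++-conicalˡ X Y e)) (balanced-++ {X} {Y} bX bY)
    ... | inside-upper B₁ refl refl nel neB₁ =
      l ++ (Y ++ X) ++ B₁ , D , ++-assoc₄ l (Y ++ X) B₁ D , upArch-swap {l} {X} {Y} {B₁} uU nel neB₁ bX bY ,
      ∼-trans {l ++ (Y ++ X) ++ B₁} {U} {U₀} (∼-step (Y , X , neY , bY , neX , bX , refl , refl) l B₁) U∼ , dD , D∼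
    ... | inside-lower A₂ refl refl neA₂ ner =
      U , A₂ ++ (Y ++ X) ++ r , ++-assoc U A₂ ((Y ++ X) ++ r) , uU , U∼ ,
      downArch-swap {A₂} {X} {Y} {r} dD neA₂ ner bX bY ,
      ∼-trans {A₂ ++ (Y ++ X) ++ r} {D} {D₀} (∼-step (Y , X , neY , bY , neX , bX , refl , refl) A₂ r) D∼
    ... | is-upper XY≡U = ⊥-elim (proj₂ (proj₂ (upArch⇒isPrime uU)) (X , Y , neX , bX , neY , bY , sym XY≡U))
    ... | is-lower XY≡D = ⊥-elim (proj₂ (proj₂ (downArch⇒isPrime {D} dD)) (X , Y , neX , bX , neY , bY , sym XY≡D))
    ... | is-product XY≡UD = ⊥-elim (¬fXY (U , D , XY≡UD , uU , U∼ , dD , D∼))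

module Representation {c ℓ : Level} (K : Field c ℓ) (RepU RepD : Word → Set)
  (reps-U : Defs.Algebra.Representatives K UpperPrime RepU)
  (reps-D : Defs.Algebra.Representatives K LowerPrime RepD) where

  open import Data.Nat using (_+_)
  open import Data.Nat.Properties using (≤-refl; +-comm; +-monoˡ-<; +-monoʳ-<; +-mono-<; m<m+n; m<n+m)
  open import Data.List.Relation.Unary.All as All using ()

  open Field K using () renaming (trans to ≈-trans; sym to ≈-sym)
  open Defs.Algebra K
  open FreeAlgebra K

  S‴⊆S : S‴ RepU RepD ⊆ S
  S‴⊆S _ _ (U , D , rU , rD , refl , refl) with proj₁ reps-U U rU | proj₁ reps-D D rD
  ... | (neU , bU , _) , _ | (neD , bD , _) , _ = U , D , neU , bU , neD , bD , refl , refl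

  SwapsUpTo : ℕ → Set (c ⊔ ℓ)
  SwapsUpTo n = ∀ X Y → Balanced X → Balanced Y → length X + length Y ≤ n → (X ++ Y) ∼[ S‴ RepU RepD ] (Y ++ X)

  swapsUpTo⇒S : ∀ {n} → SwapsUpTo n → ∀ {x y} → S x y → length x ≤ n → x ∼[ S‴ RepU RepD ] y
  swapsUpTo⇒S swaps (F , G , _ , bF , _ , bG , refl , refl) ≤n = swaps F G bF bG (subst (_≤ _) (length-++ F) ≤n)

  swap-split-left : ∀ {n} → SwapsUpTo n → ∀ {X₁ X₂ Y} → Nonempty X₁ → Balanced X₁ →
                    Nonempty X₂ → Balanced X₂ → Balanced Y → length (X₁ ++ X₂) + length Y ≤ suc n →
                    ((X₁ ++ X₂) ++ Y) ∼[ S‴ RepU RepD ] (Y ++ X₁ ++ X₂)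
  swap-split-left {n} swaps {X₁} {X₂} {Y} neX₁ bX₁ neX₂ bX₂ bY ≤1+n = begin
    (X₁ ++ X₂) ++ Y   ≡⟨ ++-assoc X₁ X₂ Y ⟩
    X₁ ++ X₂ ++ Y     ≈⟨ ∼[]-++ˡ X₁ (swaps X₂ Y bX₂ bY |X₂Y|≤n) ⟩
    X₁ ++ Y ++ X₂     ≡⟨ ++-assoc X₁ Y X₂ ⟨
    (X₁ ++ Y) ++ X₂   ≈⟨ ∼[]-++ʳ X₂ (swaps X₁ Y bX₁ bY |X₁Y|≤n) ⟩
    (Y ++ X₁) ++ X₂   ≡⟨ ++-assoc Y X₁ X₂ ⟩
    Y ++ X₁ ++ X₂     ∎
    where
    open SetoidReasoning ∼[]-setoid
    |X₁Y|≤n : length X₁ + length Y ≤ n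
    |X₁Y|≤n = m<n≤1+o⇒m≤o (+-monoˡ-< (length Y) (length-<-++ˡ X₁ neX₂)) ≤1+n
    |X₂Y|≤n : length X₂ + length Y ≤ n
    |X₂Y|≤n = m<n≤1+o⇒m≤o (+-monoˡ-< (length Y) (length-<-++ʳ X₂ neX₁)) ≤1+n

  swap-split-right : ∀ {n} → SwapsUpTo n → ∀ {X Y₁ Y₂} → Balanced X → Nonempty Y₁ → Balanced Y₁ →
                     Nonempty Y₂ → Balanced Y₂ → length X + length (Y₁ ++ Y₂) ≤ suc n →
                     (X ++ Y₁ ++ Y₂) ∼[ S‴ RepU RepD ] ((Y₁ ++ Y₂) ++ X)
  swap-split-right {n} swaps {X} {Y₁} {Y₂} bX neY₁ bY₁ neY₂ bY₂ ≤1+n = begin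
    X ++ Y₁ ++ Y₂     ≡⟨ ++-assoc X Y₁ Y₂ ⟨
    (X ++ Y₁) ++ Y₂   ≈⟨ ∼[]-++ʳ Y₂ (swaps X Y₁ bX bY₁ |XY₁|≤n) ⟩
    (Y₁ ++ X) ++ Y₂   ≡⟨ ++-assoc Y₁ X Y₂ ⟩
    Y₁ ++ X ++ Y₂     ≈⟨ ∼[]-++ˡ Y₁ (swaps X Y₂ bX bY₂ |XY₂|≤n) ⟩
    Y₁ ++ Y₂ ++ X     ≡⟨ ++-assoc Y₁ Y₂ X ⟨
    (Y₁ ++ Y₂) ++ X   ∎
    where
    open SetoidReasoning ∼[]-setoid
    |XY₁|≤n : length X + length Y₁ ≤ n
    |XY₁|≤n = m<n≤1+o⇒m≤o (+-monoʳ-< (length X) (length-<-++ˡ Y₁ neY₂)) ≤1+n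
    |XY₂|≤n : length X + length Y₂ ≤ n
    |XY₂|≤n = m<n≤1+o⇒m≤o (+-monoʳ-< (length X) (length-<-++ʳ Y₂ neY₁)) ≤1+n

  swap-mixed : ∀ {n} → SwapsUpTo n → ∀ {F G} → UpArch F → DownArch G → length F + length G ≤ suc n →
               (F ++ G) ∼[ S‴ RepU RepD ] (G ++ F)
  swap-mixed swaps {F} {G} uF dG ≤1+n
    with proj₁ (proj₂ reps-U) F (upArch⇒upperPrime uF) | proj₁ (proj₂ reps-D) G (downArch⇒lowerPrime dG)
  ... | U , rU , F∼U | D , rD , G∼D = begin
    F ++ G   ≈⟨ ∼[]-++ʳ G F≈U ⟩
    U ++ G   ≈⟨ ∼[]-++ˡ U G≈D ⟩
    U ++ D   ≈⟨ ∼[]-generator (U , D , rU , rD , refl , refl) ⟩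
    D ++ U   ≈⟨ ∼[]-++ʳ U G≈D ⟨
    G ++ U   ≈⟨ ∼[]-++ˡ G F≈U ⟨
    G ++ F   ∎
    where
    open SetoidReasoning ∼[]-setoid
    F≈U : F ∼[ S‴ RepU RepD ] U
    F≈U = lift-bounded (swapsUpTo⇒S swaps) {F} {U} F∼U
            (m<n≤1+o⇒m≤o (m<m+n (length F) (nonempty⇒0<length (downArch-nonempty {G} dG))) ≤1+n)
    G≈D : G ∼[ S‴ RepU RepD ] D
    G≈D = lift-bounded (swapsUpTo⇒S swaps) {G} {D} G∼D
            (m<n≤1+o⇒m≤o (m<n+m (length G) (nonempty⇒0<length (upArch-nonempty uF))) ≤1+n)

  -- Arches a F′ b and a G′ b of the same direction: regroup as a (F′ · b a · G′) b, where b a is balanced,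
  -- and rotate the middle by three shorter swaps.
  swap-alike : ∀ {n} → SwapsUpTo n → ∀ a b {F′ G′} → Balanced ([ b ] ++ [ a ]) →
               Balanced F′ → Balanced G′ →
               length ([ a ] ++ F′ ++ [ b ]) + length ([ a ] ++ G′ ++ [ b ]) ≤ suc n →
               (([ a ] ++ F′ ++ [ b ]) ++ ([ a ] ++ G′ ++ [ b ])) ∼[ S‴ RepU RepD ]
               (([ a ] ++ G′ ++ [ b ]) ++ ([ a ] ++ F′ ++ [ b ]))
  swap-alike swaps a b {F′} {G′} bZ bF′ bG′ ≤1+n = begin
    ([ a ] ++ F′ ++ [ b ]) ++ ([ a ] ++ G′ ++ [ b ])   ≡⟨ ++-sandwich [ a ] F′ G′ [ b ] ⟩
    [ a ] ++ (F′ ++ Z ++ G′) ++ [ b ]                 ≈⟨ ∼[]-infix [ a ] [ b ] middle ⟩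
    [ a ] ++ (G′ ++ Z ++ F′) ++ [ b ]                 ≡⟨ ++-sandwich [ a ] G′ F′ [ b ] ⟨
    ([ a ] ++ G′ ++ [ b ]) ++ ([ a ] ++ F′ ++ [ b ])   ∎
    where
    open SetoidReasoning ∼[]-setoid
    Z = [ b ] ++ [ a ]
    F G : Word
    F = [ a ] ++ F′ ++ [ b ]
    G = [ a ] ++ G′ ++ [ b ]
    |F′|<|F| : length F′ < length F
    |F′|<|F| = subst (length F′ <_) (sym (length-wrap a F′ b)) (m<n+m (length F′) (s≤s z≤n))
    |G′|<|G| : length G′ < length G
    |G′|<|G| = subst (length G′ <_) (sym (length-wrap a G′ b)) (m<n+m (length G′) (s≤s z≤n))
    F′Z∼ZF′ = swaps F′ Z bF′ bZ
      (m<n≤1+o⇒m≤o (subst (_< length F + length G) (trans (length-wrap a F′ b) (+-comm 2 (length F′)))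
                     (m<m+n (length F) (s≤s z≤n))) ≤1+n)
    F′G′∼G′F′ = swaps F′ G′ bF′ bG′ (m<n≤1+o⇒m≤o (+-mono-< |F′|<|F| |G′|<|G|) ≤1+n)
    ZG′∼G′Z = swaps Z G′ bZ bG′
      (m<n≤1+o⇒m≤o (subst (_< length F + length G) (length-wrap a G′ b) (m<n+m (length G) (s≤s z≤n))) ≤1+n)
    middle = ∼[]-rotate {X = F′} {G′} {Z} F′Z∼ZF′ F′G′∼G′F′ ZG′∼G′Z

  swap-nonempty : ∀ {n} → SwapsUpTo n → ∀ {X Y} → Nonempty X → Nonempty Y → Balanced X → Balanced Y →
                  length X + length Y ≤ suc n → (X ++ Y) ∼[ S‴ RepU RepD ] (Y ++ X)
  swap-nonempty {n} swaps {X} {Y} neX neY bX bY ≤1+n with decompose {X} bX neX | decompose {Y} bY neY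
  ... | inj₁ (X₁ , X₂ , neX₁ , bX₁ , neX₂ , bX₂ , refl) | _ =
    swap-split-left swaps neX₁ bX₁ neX₂ bX₂ bY ≤1+n
  ... | inj₂ _ | inj₁ (Y₁ , Y₂ , neY₁ , bY₁ , neY₂ , bY₂ , refl) =
    swap-split-right swaps bX neY₁ bY₁ neY₂ bY₂ ≤1+n
  ... | inj₂ (inj₁ uX) | inj₂ (inj₂ dY) = swap-mixed swaps uX dY ≤1+n
  ... | inj₂ (inj₂ dX) | inj₂ (inj₁ uY) =
    ∼[]-sym (swap-mixed swaps uY dX (subst (_≤ suc n) (+-comm (length X) (length Y)) ≤1+n))
  ... | inj₂ (inj₁ uX) | inj₂ (inj₁ uY) with upArch-inner uX | upArch-inner uY
  ...   | _ , refl , bX′ | _ , refl , bY′ = swap-alike swaps R L refl bX′ bY′ ≤1+n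
  swap-nonempty swaps {X} {Y} neX neY bX bY ≤1+n
      | inj₂ (inj₂ dX) | inj₂ (inj₂ dY) with downArch-inner {X} dX | downArch-inner {Y} dY
  ...   | _ , refl , bX′ | _ , refl , bY′ = swap-alike swaps L R refl bX′ bY′ ≤1+n

  swap-step : ∀ {n} → SwapsUpTo n → SwapsUpTo (suc n)
  swap-step swaps []          Y         _  _  _    = ∼[]-reflexive (sym (++-identityʳ Y))
  swap-step swaps X@(_ ∷ _)   []        _  _  _    = ∼[]-reflexive (++-identityʳ X)
  swap-step swaps X@(_ ∷ _)   Y@(_ ∷ _) bX bY ≤1+n = swap-nonempty swaps {X} {Y} (λ ()) (λ ()) bX bY ≤1+n

  swapsUpTo : ∀ n → SwapsUpTo n
  swapsUpTo zero    [] Y _ _ _ = ∼[]-reflexive (sym (++-identityʳ Y))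
  swapsUpTo zero    (_ ∷ _) _ _ _ ()
  swapsUpTo (suc n) = swap-step (swapsUpTo n)

  S⇒∼[S‴] : ∀ {x y} → S x y → x ∼[ S‴ RepU RepD ] y
  S⇒∼[S‴] {x} g = swapsUpTo⇒S (swapsUpTo (length x)) g ≤-refl

  InJ⇒InIdeal-S‴ : ∀ {f} → InJ f → InIdeal (S‴ RepU RepD) f
  InJ⇒InIdeal-S‴ (ts , f≈ts) with reexpress ts (All.universal (λ t → S⇒∼[S‴] (Term.gen t)) ts)
  ... | us , us≈ts = us , λ w → ≈-trans (f≈ts w) (≈-sym (us≈ts w))

  S‴-generates : Generates (S‴ RepU RepD)
  S‴-generates f = InIdeal-mono S‴⊆S , InJ⇒InIdeal-S‴

  rep-upArch : ∀ {U} → RepU U → UpArch U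
  rep-upArch {U} rU = upperPrime⇒upArch (proj₁ reps-U U rU)

  rep-downArch : ∀ {D} → RepD D → DownArch D
  rep-downArch {D} rD = lowerPrime⇒downArch (proj₁ reps-D D rD)

  module Minimality (T : GenSet) (T⊆S‴ : T ⊆ S‴ RepU RepD) {U₀ D₀} (rU₀ : RepU U₀) (rD₀ : RepD D₀)
                    (∉T : ¬ T (U₀ ++ D₀) (D₀ ++ U₀)) where
    open Factorisation U₀ D₀

    ¬factorises-UD : ∀ {U D} → RepU U → RepD D → T (U ++ D) (D ++ U) → ¬ Factorises (U ++ D)
    ¬factorises-UD {U} {D} rU rD t (U′ , D′ , UD≡ , uU′ , U′∼U₀ , _ , D′∼D₀)
      with isPrime-prefix-unique (upArch⇒isPrime (rep-upArch rU)) (upArch⇒isPrime uU′) UD≡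
    ... | refl with ++-cancelˡ U D D′ UD≡
    ...   | refl with proj₂ (proj₂ reps-U) U U₀ rU rU₀ U′∼U₀ | proj₂ (proj₂ reps-D) D D₀ rD rD₀ D′∼D₀
    ...     | refl | refl = ∉T t

    ¬factorises-DU : ∀ {U D} → RepU U → RepD D → ¬ Factorises (D ++ U)
    ¬factorises-DU rU rD (_ , _ , DU≡ , uU′ , _) = downArch-++≢upArch-++ (rep-downArch rD) uU′ DU≡

    factorises-forward : ∀ l r {x y} → T x y → Factorises (l ++ x ++ r) → Factorises (l ++ y ++ r)
    factorises-forward l r t with T⊆S‴ _ _ t
    ... | U , D , rU , rD , refl , refl =
      factorises-swap l r (upArch-nonempty uU) (upArch-balanced uU) (downArch-nonempty {D} dD) (downArch-balanced {D} dD)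
                      (¬factorises-UD rU rD t)
      where
      uU = rep-upArch rU
      dD = rep-downArch rD

    factorises-backward : ∀ l r {x y} → T x y → Factorises (l ++ y ++ r) → Factorises (l ++ x ++ r)
    factorises-backward l r t with T⊆S‴ _ _ t
    ... | U , D , rU , rD , refl , refl =
      factorises-swap l r (downArch-nonempty {D} dD) (downArch-balanced {D} dD) (upArch-nonempty uU) (upArch-balanced uU)
                      (¬factorises-DU rU rD)
      where
      uU = rep-upArch rU
      dD = rep-downArch rD

    length-T : ∀ {x y} → T x y → length x ≡ length y
    length-T t = length-S (S‴⊆S _ _ (T⊆S‴ _ _ t))

    factorises₀ : Factorises (U₀ ++ D₀)
    factorises₀ = U₀ , D₀ , refl , rep-upArch rU₀ , ∼-refl {U₀} , rep-downArch rD₀ , ∼-refl {D₀}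

    U₀D₀∼D₀U₀ : (U₀ ++ D₀) ∼ (D₀ ++ U₀)
    U₀D₀∼D₀U₀ = ∼-generator {U₀ ++ D₀} {D₀ ++ U₀} (S‴⊆S _ _ (U₀ , D₀ , rU₀ , rD₀ , refl , refl))

    ¬generates : ¬ Generates T
    ¬generates generates = ¬¬-decidable (length (U₀ ++ D₀)) Factorises λ Factorises? →
      separation length-T Factorises factorises-forward factorises-backward {U₀ ++ D₀} {D₀ ++ U₀} Factorises?
                 factorises₀ (¬factorises-DU rU₀ rD₀) (proj₂ (generates _) U₀D₀∼D₀U₀)

theorem5p8 : {c ℓ : Level} (K : Field c ℓ) → let open Defs.Algebra K in
    (RepU RepD : Word → Set) →
    Representatives UpperPrime RepU → Representatives LowerPrime RepD →
    (S‴ RepU RepD ⊆ S) × Generates (S‴ RepU RepD) ×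
    (∀ (T : GenSet) → T ⊆ S‴ RepU RepD →
       (∃[ X ] ∃[ Y ] (S‴ RepU RepD X Y × ¬ T X Y)) → ¬ Generates T)
theorem5p8 K RepU RepD reps-U reps-D = S‴⊆S , S‴-generates , minimal
  where
  open Defs.Algebra K
  open Representation K RepU RepD reps-U reps-D
  minimal : ∀ T → T ⊆ S‴ RepU RepD → (∃[ X ] ∃[ Y ] (S‴ RepU RepD X Y × ¬ T X Y)) → ¬ Generates T
  minimal T T⊆S‴ (_ , _ , (_ , _ , rU₀ , rD₀ , refl , refl) , ∉T) = Minimality.¬generates T T⊆S‴ rU₀ rD₀ ∉T
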